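{- For any string $S$ and any position $u$ with $|f^{ -1}(u)| = 2$, write $f^{ -1}(u) = \{[x_1,y_1],[x_2,y_2]\}$ with $x_1 \leq x_2$. Then $x_1 \neq x_2$, $[x_1,y_1] \in \mathcal{RS}_S$, and $[x_2,y_2] \in \mathcal{LS}_S \cup \mathcal{MS}_S$.
   Context: For a string $S$ of length $n$ and $1 \le i \le j \le n$, $S[i..j]$ is the substring from position $i$ to position $j$; a non-empty substring is unique if it occurs exactly once in $S$ and repeating if it occurs at least twice; an interval $[i,j]$ is unique/repeating according to $S[i..j]$. An interval $[i,j]$ is a minimal unique substring (MUS) if $S[i..j]$ is unique and every proper substring $S[i'..j']$ ($i\le i'$, $j'\le j$, $j'-i'<j-i$) is repeating; $\mathcal{M}_S$ is the set of all MUS intervals. $[s,t]\subset[i,j]$ means $i\le s$ and $t\le j$. An interval $[i,j]$ is a shortest unique substring (SUS) for $[s,t]$ if $S[i..j]$ is unique, $[s,t]\subset[i,j]$, and $S[i'..j']$ is repeating for every $[i',j']\supset[s,t]$ with $j'-i'<j-i$. $\mathsf{SUS}_S(p)$ is the set of SUSs for $[p,p]$ and $\mathcal{PS}_S=\bigcup_{p=1}^n\mathsf{SUS}_S(p)$. Let $\mathcal{LS}_S=\mathcal{PS}_S\cap\{[x,y]\notin\mathcal{M}_S : \exists i,\ x<i\le y,\ [i,y]\in\mathcal{M}_S\}$, $\mathcal{MS}_S=\mathcal{PS}_S\cap\mathcal{M}_S$, and $\mathcal{RS}_S=\mathcal{PS}_S\cap\{[x,y]\notin\mathcal{M}_S :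 \exists j,\ x\le j<y,\ [x,j]\in\mathcal{M}_S\}$; these three sets are pairwise disjoint and their union is $\mathcal{PS}_S$. Define $f:\mathcal{PS}_S\to\{1,\dots,n\}$ by $f([x,y])=x$ if $[x,y]\in\mathcal{LS}_S\cup\mathcal{MS}_S$ and $f([x,y])=y$ if $[x,y]\in\mathcal{RS}_S$, and $f^{ -1}(u)=\{[x,y]\in\mathcal{PS}_S : f([x,y])=u\}$. -}

module Defs where

open import Data.Nat using (ℕ; zero; suc; _+_; _∸_; _≤_; _<_)
open import Data.List using (List; []; _∷_; length)
open import Data.Maybe using (Maybe; just; nothing)
open import Data.Product using (Σ; ∃; ∃-syntax; _×_; _,_)
open import Data.Sum using (_⊎_)
open import Relation.Nullary using (¬_)
open import Relation.Binary.PropositionalEquality using (_≡_; _≢_)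

-- 1-indexed character access: charAt S p = S[p] for 1 ≤ p ≤ |S|, nothing otherwise.
charAt : {A : Set} → List A → ℕ → Maybe A
charAt []       _             = nothing
charAt (a ∷ s)  zero          = nothing
charAt (a ∷ s)  (suc zero)    = just a
charAt (a ∷ s)  (suc (suc p)) = charAt s (suc p)

module _ {A : Set} (S : List A) where

  Interval : ℕ → ℕ → Set
  Interval i j = 1 ≤ i × i ≤ j × j ≤ length S

  OccursAt : ℕ → ℕ → ℕ → Set
  OccursAt i j k = 1 ≤ k × k + (j ∸ i) ≤ length S ×
                   (∀ d → d ≤ j ∸ i → charAt S (k + d) ≡ charAt S (i + d))

  Unique : ℕ → ℕ → Set
  Unique i j = Interval i j × (∀ k → OccursAt i j k → k ≡ i)

  Repeating : ℕ → ℕ → Set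
  Repeating i j = Interval i j × ∃[ k ] (k ≢ i × OccursAt i j k)

  MUS : ℕ → ℕ → Set
  MUS i j = Unique i j ×
            (∀ i' j' → i ≤ i' → i' ≤ j' → j' ≤ j → j' ∸ i' < j ∸ i → Repeating i' j')

  SUS : ℕ → ℕ → ℕ → ℕ → Set
  SUS s t i j = Unique i j × i ≤ s × t ≤ j ×
                (∀ i' j' → Interval i' j' → i' ≤ s → t ≤ j' → j' ∸ i' < j ∸ i → Repeating i' j')

  PS : ℕ → ℕ → Set
  PS x y = ∃[ p ] (1 ≤ p × p ≤ length S × SUS p p x y)

  LS : ℕ → ℕ → Set
  LS x y = PS x y × ¬ MUS x y × ∃[ i ] (x < i × i ≤ y × MUS i y)

  MS : ℕ → ℕ → Set
  MS x y = PS x y × MUS x y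

  RS : ℕ → ℕ → Set
  RS x y = PS x y × ¬ MUS x y × ∃[ j ] (x ≤ j × j < y × MUS x j)

  -- [x,y] ∈ f⁻¹(u)
  FInv : ℕ → ℕ → ℕ → Set
  FInv u x y = ((LS x y ⊎ MS x y) × u ≡ x) ⊎ (RS x y × u ≡ y)

module Submission where

-- Proof idea.  f maps an interval of LS ∪ MS to its left end and an interval
-- of RS to its right end, so two distinct intervals with the same image u
-- fall into one of four cases, three of which are impossible:
--   * both in LS ∪ MS: they share the left end u, so one is a proper prefix
--     of the other; the longer one cannot be a SUS (LS) or a MUS (MS)
--     (`longer-prefix-not-LS∪MS`);
--   * both in RS: they share the right end u, and the one extending further
--     to the left cannot be a SUS (`RS-no-PS-proper-suffix`);
--   * [x₁,y₁] ∈ LS ∪ MS and [x₂,y₂] ∈ RS: then x₂ < y₂ = u = x₁ ≤ x₂;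
--   * [x₁,y₁] ∈ RS and [x₂,y₂] ∈ LS ∪ MS: the claimed case, with
--     x₁ < y₁ = u = x₂.
-- Every impossibility reduces to one principle: neither a SUS for a position
-- p nor a MUS can have a unique proper subinterval (containing p, for a SUS).

open import Defs
open import Data.Nat using (ℕ; _≤_; _<_; _∸_; _≤?_)
open import Data.Nat.Properties
open import Data.List using (List; length)
open import Data.Product using (_×_; _,_; proj₁; proj₂)
open import Data.Sum using (_⊎_; inj₁; inj₂)
open import Data.Empty using (⊥; ⊥-elim)
open import Relation.Nullary using (¬_; yes; no)
open import Relation.Binary.Definitions using (tri<; tri≈; tri>)
open import Relation.Binary.PropositionalEquality using (_≡_; _≢_; refl)

ProperSub : ℕ → ℕ → ℕ → ℕ → Set
ProperSub a b x y = (x < a × b ≤ y) ⊎ (x ≤ a × b < y)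

properSub-shorter : ∀ {a b x y} → a ≤ b → ProperSub a b x y → b ∸ a < y ∸ x
properSub-shorter {a} a≤b (inj₁ (x<a , b≤y)) =
  ≤-<-trans (∸-monoˡ-≤ a b≤y) (∸-monoʳ-< x<a (≤-trans a≤b b≤y))
properSub-shorter {a} {y = y} a≤b (inj₂ (x≤a , b<y)) =
  <-≤-trans (∸-monoˡ-< b<y a≤b) (∸-monoʳ-≤ y x≤a)

properSub-contained : ∀ {a b x y} → ProperSub a b x y → x ≤ a × b ≤ y
properSub-contained (inj₁ (x<a , b≤y)) = <⇒≤ x<a , b≤y
properSub-contained (inj₂ (x≤a , b<y)) = x≤a , <⇒≤ b<y

module _ {A : Set} (S : List A) where

  unique-not-repeating : ∀ {a b} → Unique S a b → ¬ Repeating S a b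
  unique-not-repeating (_ , onlyAt) (_ , k , k≢a , occ) = k≢a (onlyAt k occ)

  -- Extending a unique interval to the right (within S) keeps it unique:
  -- every occurrence of the longer string is an occurrence of its prefix.
  unique-extendʳ : ∀ {a b b'} → Unique S a b → b ≤ b' → b' ≤ length S →
                   Unique S a b'
  unique-extendʳ {a} ((1≤a , a≤b , _) , onlyAt) b≤b' b'≤n =
    (1≤a , ≤-trans a≤b b≤b' , b'≤n) ,
    λ k (1≤k , end≤n , agree) → onlyAt k
      (1≤k , ≤-trans (+-monoʳ-≤ k (∸-monoˡ-≤ a b≤b')) end≤n ,
       λ d d≤ → agree d (≤-trans d≤ (∸-monoˡ-≤ a b≤b')))

  SUS-no-unique-properSub : ∀ {p x y a b} → SUS S p p x y → Unique S a b →
    a ≤ p → p ≤ b → ProperSub a b x y → ⊥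
  SUS-no-unique-properSub (_ , _ , _ , shortest) U@(iv@(_ , a≤b , _) , _) a≤p p≤b sub =
    unique-not-repeating U
      (shortest _ _ iv a≤p p≤b (properSub-shorter a≤b sub))

  MUS-no-unique-properSub : ∀ {x y a b} → MUS S x y → Unique S a b →
    ProperSub a b x y → ⊥
  MUS-no-unique-properSub (_ , minimal) U@((_ , a≤b , _) , _) sub =
    unique-not-repeating U
      (minimal _ _ (proj₁ (properSub-contained sub)) a≤b
                   (proj₂ (properSub-contained sub)) (properSub-shorter a≤b sub))

  PS-unique : ∀ {x y} → PS S x y → Unique S x y
  PS-unique (_ , _ , _ , U , _) = U

  PS-ordered : ∀ {x y} → PS S x y → x ≤ y
  PS-ordered ps = proj₁ (proj₂ (proj₁ (PS-unique ps)))

  LS∪MS-PS : ∀ {x y} → LS S x y ⊎ MS S x y → PS S x y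
  LS∪MS-PS (inj₁ (ps , _)) = ps
  LS∪MS-PS (inj₂ (ps , _)) = ps

  -- An RS interval properly extends a MUS to the right, so it is not a
  -- single position.
  RS-nondegenerate : ∀ {x y} → RS S x y → x < y
  RS-nondegenerate (_ , _ , _ , x≤j , j<y , _) = ≤-<-trans x≤j j<y

  -- For MS, [u,y₁] is a unique proper prefix of a MUS.  For LS, with [u,y₂]
  -- a SUS for p and [i,y₂] a MUS (u < i): if p ≤ y₁ then [u,y₁] is shorter,
  -- if y₁ < p < y₂ then [u,p] is, and if p = y₂ then [i,y₂] is.
  longer-prefix-not-LS∪MS : ∀ {u y₁ y₂} → PS S u y₁ → LS S u y₂ ⊎ MS S u y₂ →
    y₁ < y₂ → ⊥
  longer-prefix-not-LS∪MS ps₁ (inj₂ (_ , mus₂)) y₁<y₂ =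
    MUS-no-unique-properSub mus₂ (PS-unique ps₁) (inj₂ (≤-refl , y₁<y₂))
  longer-prefix-not-LS∪MS {y₁ = y₁} ps₁
    (inj₁ ((p , _ , p≤n , sus@(_ , u≤p , p≤y₂ , _)) , _ , i , u<i , i≤y₂ , musᵢ)) y₁<y₂
    with p ≤? y₁
  ... | yes p≤y₁ =
    SUS-no-unique-properSub sus (PS-unique ps₁) u≤p p≤y₁ (inj₂ (≤-refl , y₁<y₂))
  ... | no p≰y₁ with m≤n⇒m<n∨m≡n p≤y₂
  ...   | inj₁ p<y₂ =
    SUS-no-unique-properSub sus (unique-extendʳ (PS-unique ps₁) (<⇒≤ (≰⇒> p≰y₁)) p≤n)
      u≤p ≤-refl (inj₂ (≤-refl , p<y₂))
  ...   | inj₂ refl =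
    SUS-no-unique-properSub sus (proj₁ musᵢ) i≤y₂ ≤-refl (inj₁ (u<i , ≤-refl))

  -- With [x₁,u] a SUS for p and [x₁,j] a MUS (j < u): if x₂ ≤ p then
  -- [x₂,u] is shorter, if p ≤ j then [x₁,j] is, and otherwise [x₁,p] is.
  RS-no-PS-proper-suffix : ∀ {u x₁ x₂} → RS S x₁ u → PS S x₂ u → x₁ < x₂ → ⊥
  RS-no-PS-proper-suffix {u} {x₂ = x₂}
    ((p , _ , p≤n , sus@(_ , x₁≤p , p≤u , _)) , _ , j , x₁≤j , j<u , musⱼ) ps₂ x₁<x₂
    with x₂ ≤? p
  ... | yes x₂≤p =
    SUS-no-unique-properSub sus (PS-unique ps₂) x₂≤p p≤u (inj₁ (x₁<x₂ , ≤-refl))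
  ... | no x₂≰p with p ≤? j
  ...   | yes p≤j =
    SUS-no-unique-properSub sus (proj₁ musⱼ) x₁≤p p≤j (inj₂ (≤-refl , j<u))
  ...   | no p≰j =
    SUS-no-unique-properSub sus (unique-extendʳ (proj₁ musⱼ) (<⇒≤ (≰⇒> p≰j)) p≤n)
      x₁≤p ≤-refl (inj₂ (≤-refl , p<u))
    where
    p<u : p < u
    p<u = <-≤-trans (≰⇒> x₂≰p) (PS-ordered ps₂)

lemma4 : {A : Set} (S : List A) (u x₁ y₁ x₂ y₂ : ℕ) →
    (x₁ , y₁) ≢ (x₂ , y₂) →
    FInv S u x₁ y₁ → FInv S u x₂ y₂ →
    (∀ x y → FInv S u x y → (x , y) ≡ (x₁ , y₁) ⊎ (x , y) ≡ (x₂ , y₂)) →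
    x₁ ≤ x₂ →
    x₁ ≢ x₂ × RS S x₁ y₁ × (LS S x₂ y₂ ⊎ MS S x₂ y₂)
-- both in LS ∪ MS: common left end, one is a proper prefix of the other
lemma4 S u x₁ y₁ x₂ y₂ distinct (inj₁ (left₁ , refl)) (inj₁ (left₂ , refl)) _ _
  with <-cmp y₁ y₂
... | tri< y₁<y₂ _ _ = ⊥-elim (longer-prefix-not-LS∪MS S (LS∪MS-PS S left₁) left₂ y₁<y₂)
... | tri≈ _ refl _  = ⊥-elim (distinct refl)
... | tri> _ _ y₂<y₁ = ⊥-elim (longer-prefix-not-LS∪MS S (LS∪MS-PS S left₂) left₁ y₂<y₁)
-- [x₂,y₂] ∈ RS with y₂ = u = x₁ ≤ x₂ contradicts x₂ < y₂
lemma4 S u x₁ y₁ x₂ y₂ _ (inj₁ (_ , refl)) (inj₂ (rs₂ , refl)) _ x₁≤x₂ =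
  ⊥-elim (<⇒≱ (RS-nondegenerate S rs₂) x₁≤x₂)
-- the claimed configuration; x₁ < y₁ = u = x₂
lemma4 S u x₁ y₁ x₂ y₂ _ (inj₂ (rs₁ , refl)) (inj₁ (left₂ , refl)) _ _ =
  <⇒≢ (RS-nondegenerate S rs₁) , rs₁ , left₂
lemma4 S u x₁ y₁ x₂ y₂ distinct (inj₂ (rs₁ , refl)) (inj₂ (rs₂ , refl)) _ x₁≤x₂
  with m≤n⇒m<n∨m≡n x₁≤x₂
... | inj₁ x₁<x₂ = ⊥-elim (RS-no-PS-proper-suffix S rs₁ (proj₁ rs₂) x₁<x₂)
... | inj₂ refl  = ⊥-elim (distinct refl)
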